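{- For every pair of integers $r,s$ with $3\le r$ and $\frac{3r}{2}+1\le s\le 2^r-1$, there exists a connected bipartite graph $G$ with stable sets $U,W$, $V(G)=U\cup W$, $|U|=r$, $|W|=s$, such that $\lambda(\overline{G})=\lambda(G)+1$.
   Context: $\overline{G}$ denotes the complement of $G$. A set $S\subseteq V$ is a locating-dominating set (LD-set) of $G$ if every vertex of $V\setminus S$ has a neighbor in $S$ and for any two distinct $u,v\in V\setminus S$, $N_G(u)\cap S\neq N_G(v)\cap S$. $\lambda(G)$ is the minimum cardinality of an LD-set of $G$. -}

module Defs where

open import Data.Nat using (ℕ; suc; _≤_)
open import Data.Bool using (Bool; true; false; not; if_then_else_)
open import Data.Fin using (Fin)
open import Data.Fin.Properties using (_≟_)
open import Data.Fin.Subset using (Subset; _∈_; _∉_; _∩_; _∪_; ⊥; ⊤; ∣_∣)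
open import Data.Vec using (tabulate)
open import Data.Product using (Σ; _×_; ∃)
open import Relation.Nullary using (¬_)
open import Relation.Nullary.Decidable using (⌊_⌋)
open import Relation.Binary.PropositionalEquality using (_≡_; _≢_)

record Graph (n : ℕ) : Set where
  field
    adj     : Fin n → Fin n → Bool
    adj-sym : ∀ u v → adj u v ≡ adj v u
    adj-irr : ∀ v → adj v v ≡ false
open Graph public

complement : ∀ {n} → Graph n → Graph n
adj (complement G) u v = if ⌊ u ≟ v ⌋ then false else not (adj G u v)
adj-sym (complement G) u v with u ≟ v | v ≟ u
... | Relation.Nullary.yes _ | Relation.Nullary.yes _ = Relation.Binary.PropositionalEquality.refl
... | Relation.Nullary.yes p | Relation.Nullary.no q = Data.Empty.⊥-elim (q (Relation.Binary.PropositionalEquality.sym p))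
  where import Data.Empty
... | Relation.Nullary.no p | Relation.Nullary.yes q = Data.Empty.⊥-elim (p (Relation.Binary.PropositionalEquality.sym q))
  where import Data.Empty
... | Relation.Nullary.no _ | Relation.Nullary.no _ = Relation.Binary.PropositionalEquality.cong not (adj-sym G u v)
adj-irr (complement G) v with v ≟ v
... | Relation.Nullary.yes _ = Relation.Binary.PropositionalEquality.refl
... | Relation.Nullary.no p = Data.Empty.⊥-elim (p Relation.Binary.PropositionalEquality.refl)
  where import Data.Empty

N : ∀ {n} → Graph n → Fin n → Subset n
N G u = tabulate (adj G u)

IsLD : ∀ {n} → Graph n → Subset n → Set
IsLD G S =
  (∀ v → v ∉ S → ∃ λ w → w ∈ S × adj G v w ≡ true)
  × (∀ u v → u ∉ S → v ∉ S → u ≢ v → (N G u ∩ S) ≢ (N G v ∩ S))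

IsLDNumber : ∀ {n} → Graph n → ℕ → Set
IsLDNumber G k =
  (Σ (Subset _) λ S → IsLD G S × ∣ S ∣ ≡ k)
  × (∀ S → IsLD G S → k ≤ ∣ S ∣)

data Walk {n} (G : Graph n) : Fin n → Fin n → Set where
  here : ∀ {v} → Walk G v v
  step : ∀ {u v w} → adj G u v ≡ true → Walk G v w → Walk G u w

Connected : ∀ {n} → Graph n → Set
Connected G = ∀ u v → Walk G u v

Stable : ∀ {n} → Graph n → Subset n → Set
Stable G X = ∀ u v → u ∈ X → v ∈ X → adj G u v ≡ false

BipartiteWith : ∀ {n} → Graph n → Subset n → Subset n → Set
BipartiteWith G U W = (U ∩ W ≡ ⊥) × (U ∪ W ≡ ⊤) × Stable G U × Stable G W

module Submission where

-- Take U = Fin r, W = Fin s and give every w ∈ W a "hole"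
-- H(w) ⊊ U; w is adjacent exactly to the vertices of U ∖ H(w).  The holes are
-- pairwise distinct, so the W-vertices have distinct neighbourhoods in U.  They
-- include ∅ (a hub adjacent to all of U), every singleton {u}, and ⌈r/2⌉
-- two-element sets covering U; the remaining holes are arbitrary further proper
-- subsets, which exist because s ≤ 2^r − 1 (subsets are coded by Fin 2^r and
-- an injection is extended).  Then U is an LD-set of G and U ∪ {hub} one of
-- the complement, so λ(G) ≤ r and λ(Ḡ) ≤ r + 1.
--
-- For an LD-set S of G or of Ḡ, two W-vertices outside S must
-- differ on S; as W is stable in G and a clique in Ḡ, they must differ on
-- S ∩ U, i.e. their holes have different traces on S ∩ U.  So in each class
-- of equal traces at most one W-vertex avoids S.  The hub and the singletons
-- of points outside S all have trace ∅, which gives |S| ≥ r; in the complement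
-- the pairs, together with domination of the hub, force one more vertex.

open import Defs
open import Data.Nat using (ℕ; _≤_; _+_; _*_; _^_; _∸_)
open import Data.Fin.Subset using (Subset; ∣_∣)
open import Data.Product using (Σ; _×_; ∃)
open import Relation.Binary.PropositionalEquality using (_≡_)

open import Data.Nat using (zero; suc; z≤n; s≤s; _<_; ⌈_/2⌉)
import Data.Nat.Properties as ℕP
open import Algebra.Properties.CommutativeSemigroup ℕP.+-commutativeSemigroup using (interchange)
open import Data.Nat.Tactic.RingSolver using (solve-∀)
open import Data.Fin using (Fin; zero; suc; _↑ˡ_; _↑ʳ_; splitAt; join; combine; funToFin; finToFun)
import Data.Fin.Properties as FinP
open import Data.Fin.Subset using (⊤; ⊥; ⁅_⁆; _∩_; _∪_; _∈_; _∉_)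
import Data.Fin.Subset.Properties as SubP
open import Data.Vec using ([]; _∷_; lookup; tabulate; _++_; tail)
import Data.Vec.Properties as VecP
open import Data.Bool using (Bool; true; false; not; _∧_; _∨_)
import Data.Bool.Properties as BoolP
open import Data.Sum using (_⊎_; inj₁; inj₂)
open import Data.Product using (_,_; proj₁; proj₂)
open import Data.Empty using (⊥-elim)
open import Function using (_∘_)
open import Function.Definitions using (Injective)
open import Relation.Nullary using (¬_; yes; no)
open import Relation.Binary.PropositionalEquality
  using (refl; sym; trans; cong; cong₂; subst; subst₂; _≢_; module ≡-Reasoning)

true≢false : true ≢ false
true≢false ()

∨-false : ∀ x y → x ∨ y ≡ false → (x ≡ false) × (y ≡ false)
∨-false false false _ = refl , refl

lookup-∉ : ∀ {n} {S : Subset n} {x} → x ∉ S → lookup S x ≡ false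
lookup-∉ {S = S} {x} x∉S = BoolP.¬-not (x∉S ∘ VecP.lookup⇒[]= x S)

lookup-∈ : ∀ {n} {S : Subset n} {x} → lookup S x ≡ true → x ∈ S
lookup-∈ {S = S} {x} = VecP.lookup⇒[]= x S

∉-from-lookup : ∀ {n} {S : Subset n} {x} → lookup S x ≡ false → x ∉ S
∉-from-lookup S[x]≡false x∈S = true≢false (trans (sym (VecP.[]=⇒lookup x∈S)) S[x]≡false)

subset-ext : ∀ {n} {p q : Subset n} → (∀ x → lookup p x ≡ lookup q x) → p ≡ q
subset-ext {p = p} {q} p≗q =
  trans (sym (VecP.tabulate∘lookup p)) (trans (VecP.tabulate-cong p≗q) (VecP.tabulate∘lookup q))

missing-element : ∀ {n} (p : Subset n) → p ≢ ⊤ → Σ (Fin n) λ u → lookup p u ≡ false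
missing-element [] p≢⊤ = ⊥-elim (p≢⊤ refl)
missing-element (false ∷ p) _ = zero , refl
missing-element (true ∷ p) p≢⊤ with missing-element p (p≢⊤ ∘ cong (true ∷_))
... | u , p[u]≡false = suc u , p[u]≡false

lookup-⊥ : ∀ {n} (x : Fin n) → lookup (⊥ {n}) x ≡ false
lookup-⊥ x = VecP.lookup-replicate x false

lookup-⊤ : ∀ {n} (x : Fin n) → lookup (⊤ {n}) x ≡ true
lookup-⊤ x = VecP.lookup-replicate x true

lookup-⁅⁆ : ∀ {n} (u : Fin n) → lookup ⁅ u ⁆ u ≡ true
lookup-⁅⁆ u = VecP.[]=⇒lookup (SubP.x∈⁅x⁆ u)

lookup-⁅⁆-≢ : ∀ {n} {u x : Fin n} → x ≢ u → lookup ⁅ u ⁆ x ≡ false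
lookup-⁅⁆-≢ x≢u = lookup-∉ (SubP.x≢y⇒x∉⁅y⁆ x≢u)

⁅⁆-injective : ∀ {n} {u v : Fin n} → ⁅ u ⁆ ≡ ⁅ v ⁆ → u ≡ v
⁅⁆-injective {u = u} {v} eq = SubP.x∈⁅y⁆⇒x≡y v (subst (u ∈_) eq (SubP.x∈⁅x⁆ u))

∣++∣ : ∀ {a b} (p : Subset a) (q : Subset b) → ∣ p ++ q ∣ ≡ ∣ p ∣ + ∣ q ∣
∣++∣ [] q = refl
∣++∣ (true ∷ p) q = cong suc (∣++∣ p q)
∣++∣ (false ∷ p) q = ∣++∣ p q

lookup-trace : ∀ {n} (f : Fin n → Bool) (S : Subset n) x →
  lookup (tabulate f ∩ S) x ≡ f x ∧ lookup S x
lookup-trace f S x =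
  trans (VecP.lookup-zipWith _∧_ x (tabulate f) S) (cong (_∧ lookup S x) (VecP.lookup∘tabulate f x))

traces-agree : ∀ {n} {f g : Fin n → Bool} {S : Subset n} → tabulate f ∩ S ≡ tabulate g ∩ S →
  ∀ x → lookup S x ≡ true → f x ≡ g x
traces-agree {f = f} {g} {S} eq x S[x] = begin
  f x                        ≡⟨ sym (BoolP.∧-identityʳ (f x)) ⟩
  f x ∧ true                 ≡⟨ cong (f x ∧_) (sym S[x]) ⟩
  f x ∧ lookup S x           ≡⟨ sym (lookup-trace f S x) ⟩
  lookup (tabulate f ∩ S) x  ≡⟨ cong (λ T → lookup T x) eq ⟩
  lookup (tabulate g ∩ S) x  ≡⟨ lookup-trace g S x ⟩
  g x ∧ lookup S x           ≡⟨ cong (g x ∧_) S[x] ⟩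
  g x ∧ true                 ≡⟨ BoolP.∧-identityʳ (g x) ⟩
  g x                        ∎
  where open ≡-Reasoning

traces-equal : ∀ {n} (f g : Fin n → Bool) (S : Subset n) →
  (∀ x → lookup S x ≡ true → f x ≡ g x) → tabulate f ∩ S ≡ tabulate g ∩ S
traces-equal f g S f≗g = subset-ext λ x →
  trans (lookup-trace f S x) (trans (agree x (lookup S x) refl) (sym (lookup-trace g S x)))
  where
  agree : ∀ x b → lookup S x ≡ b → f x ∧ b ≡ g x ∧ b
  agree x true S[x] = cong (_∧ true) (f≗g x S[x])
  agree x false _ = trans (BoolP.∧-zeroʳ (f x)) (sym (BoolP.∧-zeroʳ (g x)))

bit : Bool → ℕ
bit true = 1
bit false = 0

count : ∀ {n} → (Fin n → Bool) → ℕ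
count {zero} f = 0
count {suc n} f = bit (f zero) + count (f ∘ suc)

∣∣≡count : ∀ {n} (S : Subset n) → ∣ S ∣ ≡ count (lookup S)
∣∣≡count [] = refl
∣∣≡count (true ∷ S) = cong suc (∣∣≡count S)
∣∣≡count (false ∷ S) = ∣∣≡count S

count-++ : ∀ a {b} (f : Fin (a + b) → Bool) →
  count f ≡ count (λ i → f (i ↑ˡ b)) + count (λ j → f (a ↑ʳ j))
count-++ zero f = refl
count-++ (suc a) f =
  trans (cong (bit (f zero) +_) (count-++ a (f ∘ suc))) (sym (ℕP.+-assoc (bit (f zero)) _ _))

count-all : ∀ {n} (f : Fin n → Bool) → (∀ i → f i ≡ true) → n ≤ count f
count-all {zero} f _ = z≤n
count-all {suc n} f all rewrite all zero = s≤s (count-all (f ∘ suc) (all ∘ suc))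

count-≥1 : ∀ {n} (f : Fin n → Bool) i → f i ≡ true → 1 ≤ count f
count-≥1 f zero fi rewrite fi = s≤s z≤n
count-≥1 f (suc i) fi = ℕP.≤-trans (count-≥1 (f ∘ suc) i fi) (ℕP.m≤n+m _ (bit (f zero)))

count-all-but : ∀ {n} (f : Fin n → Bool) i₀ → (∀ i → i ≢ i₀ → f i ≡ true) → n ≤ suc (count f)
count-all-but f zero rest =
  s≤s (ℕP.≤-trans (count-all (f ∘ suc) (λ i → rest (suc i) λ ())) (ℕP.m≤n+m _ (bit (f zero))))
count-all-but f (suc i₀) rest rewrite rest zero (λ ()) =
  s≤s (count-all-but (f ∘ suc) i₀ (λ i i≢i₀ → rest (suc i) (i≢i₀ ∘ FinP.suc-injective)))

count-∨∧ : ∀ {n} (f g : Fin n → Bool) →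
  count f + count g ≡ count (λ i → f i ∨ g i) + count (λ i → f i ∧ g i)
count-∨∧ {zero} f g = refl
count-∨∧ {suc n} f g = begin
  (bit a + count f′) + (bit b + count g′)  ≡⟨ interchange (bit a) _ (bit b) _ ⟩
  (bit a + bit b) + (count f′ + count g′)  ≡⟨ cong₂ _+_ (bits a b) (count-∨∧ f′ g′) ⟩
  (bit (a ∨ b) + bit (a ∧ b)) + (count (λ i → f′ i ∨ g′ i) + count (λ i → f′ i ∧ g′ i))
    ≡⟨ interchange (bit (a ∨ b)) _ _ _ ⟩
  (bit (a ∨ b) + count (λ i → f′ i ∨ g′ i)) + (bit (a ∧ b) + count (λ i → f′ i ∧ g′ i)) ∎
  where
  open ≡-Reasoning
  a b : Bool
  a = f zero
  b = g zero
  f′ g′ : Fin n → Bool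
  f′ = f ∘ suc
  g′ = g ∘ suc
  bits : ∀ a b → bit a + bit b ≡ bit (a ∨ b) + bit (a ∧ b)
  bits true true = refl
  bits true false = refl
  bits false true = refl
  bits false false = refl

count-almost-all : ∀ {n} (f : Fin n → Bool) (b : Bool) →
  (∀ i j → i ≢ j → f i ≡ false → ¬ (f j ≡ false)) → (∀ i → f i ≡ false → b ≡ true) →
  n ≤ bit b + count f
count-almost-all f b one-gap gap⇒b with FinP.all? (λ i → f i BoolP.≟ true)
... | yes all = ℕP.≤-trans (count-all f all) (ℕP.m≤n+m _ (bit b))
... | no ¬all with FinP.¬∀⟶∃¬ _ _ (λ i → f i BoolP.≟ true) ¬all
...   | i₀ , f[i₀]≢true = subst (λ c → _ ≤ bit c + count f) (sym (gap⇒b i₀ f[i₀]≡false))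
          (count-all-but f i₀ (λ i i≢i₀ → BoolP.¬-not λ f[i]≡false →
            one-gap i₀ i (i≢i₀ ∘ sym) f[i₀]≡false f[i]≡false))
  where
  f[i₀]≡false : f i₀ ≡ false
  f[i₀]≡false = BoolP.¬-not f[i₀]≢true

-- Coding subsets of Fin r by Fin 2^r (through their characteristic functions
-- into Fin 2, using the library bijection between Fin (2 ^ r) and Fin r → Fin 2).

toFin2 : Bool → Fin 2
toFin2 false = zero
toFin2 true = suc zero

fromFin2 : Fin 2 → Bool
fromFin2 zero = false
fromFin2 (suc zero) = true

fromFin2∘toFin2 : ∀ b → fromFin2 (toFin2 b) ≡ b
fromFin2∘toFin2 false = refl
fromFin2∘toFin2 true = refl

toFin2∘fromFin2 : ∀ i → toFin2 (fromFin2 i) ≡ i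
toFin2∘fromFin2 zero = refl
toFin2∘fromFin2 (suc zero) = refl

funToFin-cong : ∀ {m n} {f g : Fin m → Fin n} → (∀ i → f i ≡ g i) → funToFin f ≡ funToFin g
funToFin-cong {zero} f≗g = refl
funToFin-cong {suc m} f≗g = cong₂ combine (f≗g zero) (funToFin-cong (f≗g ∘ suc))

code : ∀ {r} → Subset r → Fin (2 ^ r)
code S = funToFin (toFin2 ∘ lookup S)

decode : ∀ r → Fin (2 ^ r) → Subset r
decode r k = tabulate (fromFin2 ∘ finToFun k)

decode∘code : ∀ {r} (S : Subset r) → decode r (code S) ≡ S
decode∘code S = trans
  (VecP.tabulate-cong λ i →
    trans (cong fromFin2 (FinP.finToFun-funToFin (toFin2 ∘ lookup S) i)) (fromFin2∘toFin2 _))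
  (VecP.tabulate∘lookup S)

code∘decode : ∀ r (k : Fin (2 ^ r)) → code (decode r k) ≡ k
code∘decode r k = trans
  (funToFin-cong {r} λ i →
    trans (cong toFin2 (VecP.lookup∘tabulate (fromFin2 ∘ finToFun k) i)) (toFin2∘fromFin2 _))
  (FinP.funToFin-finToFin {r} k)

code-injective : ∀ {r} {X Y : Subset r} → code X ≡ code Y → X ≡ Y
code-injective {r} {X} {Y} eq = trans (sym (decode∘code X)) (trans (cong (decode r) eq) (decode∘code Y))

decode-injective : ∀ r {k l : Fin (2 ^ r)} → decode r k ≡ decode r l → k ≡ l
decode-injective r {k} {l} eq = trans (sym (code∘decode r k)) (trans (cong code eq) (code∘decode r l))

missed-value : ∀ {L M} (k : Fin L → Fin M) → L < M → Σ (Fin M) λ y → ∀ i → k i ≢ y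
missed-value {L} {M} k L<M with FinP.all? (λ y → FinP.any? (λ i → k i FinP.≟ y))
... | yes hit = ⊥-elim (ℕP.<⇒≱ L<M (FinP.injective⇒≤ preimage-injective))
  where
  preimage-injective : Injective _≡_ _≡_ (λ y → proj₁ (hit y))
  preimage-injective {y} {y′} eq =
    trans (sym (proj₂ (hit y))) (trans (cong k eq) (proj₂ (hit y′)))
... | no ¬hit with FinP.¬∀⟶∃¬ M _ (λ y → FinP.any? (λ i → k i FinP.≟ y)) ¬hit
...   | y , ¬hit-y = y , λ i k[i]≡y → ¬hit-y (i , k[i]≡y)

cons : ∀ {L M} → Fin M → (Fin L → Fin M) → Fin (suc L) → Fin M
cons y g zero = y
cons y g (suc j) = g j

cons-injective : ∀ {L M} {y : Fin M} {g : Fin L → Fin M} →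
  Injective _≡_ _≡_ g → (∀ j → g j ≢ y) → Injective _≡_ _≡_ (cons y g)
cons-injective g-inj fresh {zero} {zero} _ = refl
cons-injective g-inj fresh {zero} {suc j} eq = ⊥-elim (fresh j (sym eq))
cons-injective g-inj fresh {suc i} {zero} eq = ⊥-elim (fresh i eq)
cons-injective g-inj fresh {suc i} {suc j} eq = cong suc (g-inj eq)

extend : ∀ {K M} (t : Fin M) (h : Fin K → Fin M) → Injective _≡_ _≡_ h → (∀ i → h i ≢ t) →
  ∀ m → suc (m + K) ≤ M →
  Σ (Fin (m + K) → Fin M) λ g →
    Injective _≡_ _≡_ g × (∀ i → g (m ↑ʳ i) ≡ h i) × (∀ j → g j ≢ t)
extend t h h-inj h≢t zero _ = h , h-inj , (λ _ → refl) , h≢t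
extend t h h-inj h≢t (suc m) room
  with extend t h h-inj h≢t m (ℕP.≤-trans (ℕP.n≤1+n _) room)
... | g , g-inj , g-ext , g≢t
  with missed-value (cons t g) room
...   | y , y-fresh =
  cons y g , cons-injective g-inj (y-fresh ∘ suc) , g-ext , cons-avoids
  where
  cons-avoids : ∀ j → cons y g j ≢ t
  cons-avoids zero y≡t = y-fresh zero (sym y≡t)
  cons-avoids (suc j) = g≢t j

card-≢ : ∀ {n} {X Y : Subset n} {a b} → ∣ X ∣ ≡ a → ∣ Y ∣ ≡ b → a ≢ b → X ≢ Y
card-≢ ∣X∣≡a ∣Y∣≡b a≢b X≡Y = a≢b (trans (sym ∣X∣≡a) (trans (cong ∣_∣ X≡Y) ∣Y∣≡b))

-- The pairs {0,1}, {2,3}, … of Fin (2 + t), the last one being {t, t+1} when t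
-- is odd: ⌈ (2 + t)/2 ⌉ two-element sets covering Fin (2 + t).
pair : ∀ t → Fin ⌈ suc (suc t) /2⌉ → Subset (suc (suc t))
pair t zero = true ∷ true ∷ ⊥
pair (suc zero) (suc zero) = false ∷ true ∷ true ∷ []
pair (suc (suc t)) (suc p) = false ∷ false ∷ pair t p

pair-card : ∀ t p → ∣ pair t p ∣ ≡ 2
pair-card t zero = cong (λ k → suc (suc k)) (SubP.∣⊥∣≡0 t)
pair-card (suc zero) (suc zero) = refl
pair-card (suc (suc t)) (suc p) = pair-card t p

pair-injective : ∀ t {p q} → pair t p ≡ pair t q → p ≡ q
pair-injective t {zero} {zero} _ = refl
pair-injective (suc zero) {zero} {suc zero} ()
pair-injective (suc zero) {suc zero} {zero} ()
pair-injective (suc zero) {suc zero} {suc zero} _ = refl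
pair-injective (suc (suc t)) {zero} {suc q} ()
pair-injective (suc (suc t)) {suc p} {zero} ()
pair-injective (suc (suc t)) {suc p} {suc q} eq = cong suc (pair-injective t (cong (tail ∘ tail) eq))

pair-covers : ∀ t (u : Fin (suc (suc t))) → Σ (Fin ⌈ suc (suc t) /2⌉) λ p → Σ (Fin (suc (suc t))) λ z →
  z ≢ u × (∀ x → x ≢ u → lookup (pair t p) x ≡ lookup ⁅ z ⁆ x)
pair-covers t zero = zero , suc zero , (λ ()) , λ
  { zero 0≢0 → ⊥-elim (0≢0 refl) ; (suc zero) _ → refl ; (suc (suc y)) _ → refl }
pair-covers t (suc zero) = zero , zero , (λ ()) , λ
  { zero _ → refl ; (suc zero) 1≢1 → ⊥-elim (1≢1 refl) ; (suc (suc y)) _ → refl }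
pair-covers (suc zero) (suc (suc zero)) = suc zero , suc zero , (λ ()) , λ
  { zero _ → refl ; (suc zero) _ → refl ; (suc (suc zero)) 2≢2 → ⊥-elim (2≢2 refl) }
pair-covers (suc (suc t)) (suc (suc u)) with pair-covers t u
... | p , z , z≢u , agree = suc p , suc (suc z) , z≢u ∘ FinP.suc-injective ∘ FinP.suc-injective , λ
  { zero _ → refl ; (suc zero) _ → refl ; (suc (suc x)) x≢u → agree x λ x≡u → x≢u (cong (λ y → suc (suc y)) x≡u) }

module Specials (t : ℕ) where

  r h : ℕ
  r = suc (suc (suc t))
  h = ⌈ r /2⌉

  special′ : Fin r ⊎ Fin h → Subset r
  special′ (inj₁ u) = ⁅ u ⁆
  special′ (inj₂ p) = pair (suc t) p

  special : Fin (suc (r + h)) → Subset r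
  special zero = ⊥
  special (suc k) = special′ (splitAt r k)

  -- Singletons and pairs have one or two elements; this separates them from
  -- ∅, from each other, and from ⊤.
  special′-card : ∀ v → Σ ℕ λ c → ∣ special′ v ∣ ≡ suc c × c ≤ 1
  special′-card (inj₁ u) = 0 , SubP.∣⁅x⁆∣≡1 u , z≤n
  special′-card (inj₂ p) = 1 , pair-card (suc t) p , s≤s z≤n

  special′-injective : Injective _≡_ _≡_ special′
  special′-injective {inj₁ u} {inj₁ v} eq = cong inj₁ (⁅⁆-injective eq)
  special′-injective {inj₁ u} {inj₂ p} eq = ⊥-elim (card-≢ (SubP.∣⁅x⁆∣≡1 u) (pair-card (suc t) p) (λ ()) eq)
  special′-injective {inj₂ p} {inj₁ u} eq = ⊥-elim (card-≢ (pair-card (suc t) p) (SubP.∣⁅x⁆∣≡1 u) (λ ()) eq)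
  special′-injective {inj₂ p} {inj₂ q} eq = cong inj₂ (pair-injective (suc t) eq)

  special-injective : Injective _≡_ _≡_ special
  special-injective {zero} {zero} _ = refl
  special-injective {zero} {suc k} eq with special′-card (splitAt r k)
  ... | _ , ∣∣≡suc , _ = ⊥-elim (card-≢ (SubP.∣⊥∣≡0 r) ∣∣≡suc (λ ()) eq)
  special-injective {suc k} {zero} eq with special′-card (splitAt r k)
  ... | _ , ∣∣≡suc , _ = ⊥-elim (card-≢ ∣∣≡suc (SubP.∣⊥∣≡0 r) (λ ()) eq)
  special-injective {suc k} {suc k′} eq = cong suc (begin
    k                       ≡⟨ sym (FinP.join-splitAt r h k) ⟩
    join r h (splitAt r k)  ≡⟨ cong (join r h) (special′-injective {splitAt r k} {splitAt r k′} eq) ⟩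
    join r h (splitAt r k′) ≡⟨ FinP.join-splitAt r h k′ ⟩
    k′                      ∎)
    where open ≡-Reasoning

  -- Special holes have at most two elements, while r ≥ 3.
  special≢⊤ : ∀ k → special k ≢ ⊤
  special≢⊤ zero = card-≢ (SubP.∣⊥∣≡0 r) (SubP.∣⊤∣≡n r) (λ ())
  special≢⊤ (suc k) with special′-card (splitAt r k)
  ... | c , ∣∣≡suc-c , c≤1 = card-≢ ∣∣≡suc-c (SubP.∣⊤∣≡n r) λ suc-c≡r →
    too-big (subst (_≤ 1) (ℕP.suc-injective suc-c≡r) c≤1)
    where
    too-big : ¬ (suc (suc t) ≤ 1)
    too-big (s≤s ())

_++ʷ_ : ∀ {n} {H : Graph n} {a b c} → Walk H a b → Walk H b c → Walk H a c
here ++ʷ w′ = w′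
step e w ++ʷ w′ = step e (w ++ʷ w′)

reverse : ∀ {n} {H : Graph n} {a b} → Walk H a b → Walk H b a
reverse here = here
reverse {H = H} (step {a} {b} e w) = reverse w ++ʷ step (trans (adj-sym H b a) e) here

complement-adj : ∀ {n} (H : Graph n) {a x} → a ≢ x → adj (complement H) a x ≡ not (adj H a x)
complement-adj H {a} {x} a≢x with a FinP.≟ x
... | yes a≡x = ⊥-elim (a≢x a≡x)
... | no _ = refl

-- S separates H when no two distinct vertices outside S see S alike.  This is
-- the location half of being an LD-set, and it holds for H whenever S is an
-- LD-set of H or of its complement.
Separating : ∀ {n} → Graph n → Subset n → Set
Separating H S = ∀ a b → lookup S a ≡ false → lookup S b ≡ false → a ≢ b →
  ¬ (∀ x → lookup S x ≡ true → adj H a x ≡ adj H b x)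

LD⇒separating : ∀ {n} (H : Graph n) (S : Subset n) → IsLD H S → Separating H S
LD⇒separating H S (_ , locate) a b S[a] S[b] a≢b same =
  locate a b (∉-from-lookup S[a]) (∉-from-lookup S[b]) a≢b (traces-equal _ _ S same)

complement-LD⇒separating : ∀ {n} (H : Graph n) (S : Subset n) → IsLD (complement H) S → Separating H S
complement-LD⇒separating H S (_ , locate) a b S[a] S[b] a≢b same =
  locate a b (∉-from-lookup S[a]) (∉-from-lookup S[b]) a≢b (traces-equal _ _ S same-in-complement)
  where
  outside≢inside : ∀ {y x} → lookup S y ≡ false → lookup S x ≡ true → y ≢ x
  outside≢inside S[y] S[x] refl = true≢false (trans (sym S[x]) S[y])
  same-in-complement : ∀ x → lookup S x ≡ true → adj (complement H) a x ≡ adj (complement H) b x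
  same-in-complement x S[x] = begin
    adj (complement H) a x  ≡⟨ complement-adj H (outside≢inside S[a] S[x]) ⟩
    not (adj H a x)         ≡⟨ cong not (same x S[x]) ⟩
    not (adj H b x)         ≡⟨ sym (complement-adj H (outside≢inside S[b] S[x])) ⟩
    adj (complement H) b x  ∎
    where open ≡-Reasoning

-- The hole graph: U = Fin r, W = Fin s, and the W-vertex j is adjacent to the
-- U-vertex u iff u is not in hole j.  Vertices are Fin (r + s), U first.
module HoleGraph (r s : ℕ) (hole : Fin s → Subset r) where

  link : Fin r ⊎ Fin s → Fin r ⊎ Fin s → Bool
  link (inj₁ u) (inj₂ j) = not (lookup (hole j) u)
  link (inj₂ j) (inj₁ u) = not (lookup (hole j) u)
  link (inj₁ _) (inj₁ _) = false
  link (inj₂ _) (inj₂ _) = false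

  link-sym : ∀ a b → link a b ≡ link b a
  link-sym (inj₁ u) (inj₂ j) = refl
  link-sym (inj₂ j) (inj₁ u) = refl
  link-sym (inj₁ _) (inj₁ _) = refl
  link-sym (inj₂ _) (inj₂ _) = refl

  link-irr : ∀ a → link a a ≡ false
  link-irr (inj₁ _) = refl
  link-irr (inj₂ _) = refl

  G : Graph (r + s)
  G = record
    { adj = λ x y → link (splitAt r x) (splitAt r y)
    ; adj-sym = λ x y → link-sym (splitAt r x) (splitAt r y)
    ; adj-irr = λ x → link-irr (splitAt r x)
    }

  uv : Fin r → Fin (r + s)
  uv u = u ↑ˡ s

  wv : Fin s → Fin (r + s)
  wv j = r ↑ʳ j

  data Side : Fin (r + s) → Set where
    inU : ∀ u → Side (uv u)
    inW : ∀ j → Side (wv j)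

  side : ∀ x → Side x
  side x = subst Side (FinP.join-splitAt r s x) (side′ (splitAt r x))
    where
    side′ : ∀ v → Side (join r s v)
    side′ (inj₁ u) = inU u
    side′ (inj₂ j) = inW j

  adj-UU : ∀ u v → adj G (uv u) (uv v) ≡ false
  adj-UU u v = cong₂ link (FinP.splitAt-↑ˡ r u s) (FinP.splitAt-↑ˡ r v s)

  adj-WW : ∀ j k → adj G (wv j) (wv k) ≡ false
  adj-WW j k = cong₂ link (FinP.splitAt-↑ʳ r s j) (FinP.splitAt-↑ʳ r s k)

  adj-WU : ∀ j u → adj G (wv j) (uv u) ≡ not (lookup (hole j) u)
  adj-WU j u = cong₂ link (FinP.splitAt-↑ʳ r s j) (FinP.splitAt-↑ˡ r u s)

  wv≢uv : ∀ j u → wv j ≢ uv u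
  wv≢uv j u eq with trans (sym (FinP.splitAt-↑ʳ r s j)) (trans (cong (splitAt r) eq) (FinP.splitAt-↑ˡ r u s))
  ... | ()

  complement-WU : ∀ j u → adj (complement G) (wv j) (uv u) ≡ lookup (hole j) u
  complement-WU j u = trans (complement-adj G (wv≢uv j u))
    (trans (cong not (adj-WU j u)) (BoolP.not-involutive _))

  lookup-U : ∀ (p : Subset r) (q : Subset s) u → lookup (p ++ q) (uv u) ≡ lookup p u
  lookup-U p q u = VecP.lookup-++ˡ p q u

  lookup-W : ∀ (p : Subset r) (q : Subset s) j → lookup (p ++ q) (wv j) ≡ lookup q j
  lookup-W p q j = VecP.lookup-++ʳ p q j

  Uset Wset : Subset (r + s)
  Uset = ⊤ {r} ++ ⊥ {s}
  Wset = ⊥ {r} ++ ⊤ {s}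

  Uset-size : ∣ Uset ∣ ≡ r
  Uset-size = trans (∣++∣ (⊤ {r}) (⊥ {s}))
    (trans (cong₂ _+_ (SubP.∣⊤∣≡n r) (SubP.∣⊥∣≡0 s)) (ℕP.+-identityʳ r))

  Wset-size : ∣ Wset ∣ ≡ s
  Wset-size = trans (∣++∣ (⊥ {r}) (⊤ {s})) (cong₂ _+_ (SubP.∣⊥∣≡0 r) (SubP.∣⊤∣≡n s))

  U∈Uset : ∀ u → lookup Uset (uv u) ≡ true
  U∈Uset u = trans (lookup-U ⊤ ⊥ u) (lookup-⊤ u)

  W∉Uset : ∀ j → lookup Uset (wv j) ≡ false
  W∉Uset j = trans (lookup-W ⊤ ⊥ j) (lookup-⊥ j)

  U∉Wset : ∀ u → lookup Wset (uv u) ≡ false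
  U∉Wset u = trans (lookup-U ⊥ ⊤ u) (lookup-⊥ u)

  W∈Wset : ∀ j → lookup Wset (wv j) ≡ true
  W∈Wset j = trans (lookup-W ⊥ ⊤ j) (lookup-⊤ j)

  bipartite : BipartiteWith G Uset Wset
  bipartite = disjoint , covering , stable-U , stable-W
    where
    in-both : ∀ x → lookup Uset x ∧ lookup Wset x ≡ false
    in-both x with side x
    ... | inU u = trans (cong₂ _∧_ (U∈Uset u) (U∉Wset u)) refl
    ... | inW j = cong (_∧ lookup Wset (wv j)) (W∉Uset j)
    in-either : ∀ x → lookup Uset x ∨ lookup Wset x ≡ true
    in-either x with side x
    ... | inU u = cong (_∨ lookup Wset (uv u)) (U∈Uset u)
    ... | inW j = cong₂ _∨_ (W∉Uset j) (W∈Wset j)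
    disjoint : Uset ∩ Wset ≡ ⊥
    disjoint = subset-ext λ x → trans (VecP.lookup-zipWith _∧_ x Uset Wset)
      (trans (in-both x) (sym (lookup-⊥ x)))
    covering : Uset ∪ Wset ≡ ⊤
    covering = subset-ext λ x → trans (VecP.lookup-zipWith _∨_ x Uset Wset)
      (trans (in-either x) (sym (lookup-⊤ x)))
    stable-U : Stable G Uset
    stable-U a b a∈U b∈U with side a | side b
    ... | inW j | _ = ⊥-elim (∉-from-lookup (W∉Uset j) a∈U)
    ... | inU _ | inW k = ⊥-elim (∉-from-lookup (W∉Uset k) b∈U)
    ... | inU u | inU v = adj-UU u v
    stable-W : Stable G Wset
    stable-W a b a∈W b∈W with side a | side b
    ... | inU u | _ = ⊥-elim (∉-from-lookup (U∉Wset u) a∈W)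
    ... | inW _ | inU v = ⊥-elim (∉-from-lookup (U∉Wset v) b∈W)
    ... | inW j | inW k = adj-WW j k

  separated-holes : ∀ S → Separating G S → ∀ j k → lookup S (wv j) ≡ false → lookup S (wv k) ≡ false →
    j ≢ k → ¬ (∀ u → lookup S (uv u) ≡ true → lookup (hole j) u ≡ lookup (hole k) u)
  separated-holes S separating j k S[j] S[k] j≢k same-on-S =
    separating (wv j) (wv k) S[j] S[k] (j≢k ∘ FinP.↑ʳ-injective r j k) same-adjacency
    where
    same-adjacency : ∀ x → lookup S x ≡ true → adj G (wv j) x ≡ adj G (wv k) x
    same-adjacency x S[x] with side x
    ... | inU u = trans (adj-WU j u) (trans (cong not (same-on-S u S[x])) (sym (adj-WU k u)))
    ... | inW l = trans (adj-WW j l) (sym (adj-WW k l))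

  U-neighbour : ∀ j → hole j ≢ ⊤ → Σ (Fin r) λ u → adj G (wv j) (uv u) ≡ true
  U-neighbour j proper with missing-element (hole j) proper
  ... | u , u∉hole = u , trans (adj-WU j u) (cong not u∉hole)

  -- A W-vertex with empty hole is adjacent to all of U; through it, G is connected.
  connected : (∀ j → hole j ≢ ⊤) → ∀ j₀ → hole j₀ ≡ ⊥ → Connected G
  connected proper j₀ hole≡⊥ a b = to-hub a ++ʷ reverse (to-hub b)
    where
    hub-edge : ∀ u → adj G (uv u) (wv j₀) ≡ true
    hub-edge u = trans (adj-sym G (uv u) (wv j₀)) (trans (adj-WU j₀ u)
      (cong not (trans (cong (λ p → lookup p u) hole≡⊥) (lookup-⊥ u))))
    to-hub : ∀ x → Walk G x (wv j₀)
    to-hub x with side x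
    ... | inU u = step (hub-edge u) here
    ... | inW j with U-neighbour j (proper j)
    ...   | u , j~u = step j~u (step (hub-edge u) here)

  -- U is an LD-set of G: W-vertices have neighbours in U and distinct holes.
  U-locating : (∀ j → hole j ≢ ⊤) → Injective _≡_ _≡_ hole → IsLD G Uset
  U-locating proper hole-inj = dominating , locating
    where
    dominating : ∀ v → v ∉ Uset → ∃ λ w → w ∈ Uset × adj G v w ≡ true
    dominating v v∉U with side v
    ... | inU u = ⊥-elim (v∉U (lookup-∈ (U∈Uset u)))
    ... | inW j with U-neighbour j (proper j)
    ...   | u , j~u = uv u , lookup-∈ (U∈Uset u) , j~u
    locating : ∀ a b → a ∉ Uset → b ∉ Uset → a ≢ b → (N G a ∩ Uset) ≢ (N G b ∩ Uset)
    locating a b a∉U b∉U a≢b same with side a | side b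
    ... | inU u | _ = a∉U (lookup-∈ (U∈Uset u))
    ... | inW _ | inU u = b∉U (lookup-∈ (U∈Uset u))
    ... | inW j | inW k = a≢b (cong wv (hole-inj (subset-ext λ u → BoolP.not-injective (
          trans (sym (adj-WU j u)) (trans (traces-agree same (uv u) (U∈Uset u)) (adj-WU k u))))))

  U+ : Fin s → Subset (r + s)
  U+ j₀ = ⊤ {r} ++ ⁅ j₀ ⁆

  U+-size : ∀ j₀ → ∣ U+ j₀ ∣ ≡ r + 1
  U+-size j₀ = trans (∣++∣ (⊤ {r}) ⁅ j₀ ⁆) (cong₂ _+_ (SubP.∣⊤∣≡n r) (SubP.∣⁅x⁆∣≡1 j₀))

  U⊆U+ : ∀ j₀ u → lookup (U+ j₀) (uv u) ≡ true
  U⊆U+ j₀ u = trans (lookup-U ⊤ ⁅ j₀ ⁆ u) (lookup-⊤ u)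

  -- U+ j₀ is an LD-set of the complement: W is a clique there, so j₀ dominates
  -- the rest of W, and the complement sees the holes themselves on U.
  U+-locating : Injective _≡_ _≡_ hole → ∀ j₀ → IsLD (complement G) (U+ j₀)
  U+-locating hole-inj j₀ = dominating , locating
    where
    j₀∈U+ : wv j₀ ∈ U+ j₀
    j₀∈U+ = lookup-∈ (trans (lookup-W ⊤ ⁅ j₀ ⁆ j₀) (lookup-⁅⁆ j₀))
    dominating : ∀ v → v ∉ U+ j₀ → ∃ λ w → w ∈ U+ j₀ × adj (complement G) v w ≡ true
    dominating v v∉U+ with side v
    ... | inU u = ⊥-elim (v∉U+ (lookup-∈ (U⊆U+ j₀ u)))
    ... | inW j = wv j₀ , j₀∈U+ , trans (complement-adj G j≢j₀) (cong not (adj-WW j j₀))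
      where
      j≢j₀ : wv j ≢ wv j₀
      j≢j₀ eq = v∉U+ (subst (_∈ U+ j₀) (sym eq) j₀∈U+)
    locating : ∀ a b → a ∉ U+ j₀ → b ∉ U+ j₀ → a ≢ b →
      (N (complement G) a ∩ U+ j₀) ≢ (N (complement G) b ∩ U+ j₀)
    locating a b a∉U+ b∉U+ a≢b same with side a | side b
    ... | inU u | _ = a∉U+ (lookup-∈ (U⊆U+ j₀ u))
    ... | inW _ | inU u = b∉U+ (lookup-∈ (U⊆U+ j₀ u))
    ... | inW j | inW k = a≢b (cong wv (hole-inj (subset-ext λ u →
          trans (sym (complement-WU j u)) (trans (traces-agree same (uv u) (U⊆U+ j₀ u)) (complement-WU k u)))))

  -- A W-vertex with empty hole has no U-neighbour in the complement, so an
  -- LD-set of the complement avoiding it must contain a W-vertex.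
  hub-dominated : ∀ j₀ → hole j₀ ≡ ⊥ → ∀ S → IsLD (complement G) S →
    lookup S (wv j₀) ≡ false → Σ (Fin s) λ j → lookup S (wv j) ≡ true
  hub-dominated j₀ hole≡⊥ S (dominating , _) S[j₀] with dominating (wv j₀) (∉-from-lookup S[j₀])
  ... | x , x∈S , j₀~x with side x
  ...   | inW j = j , VecP.[]=⇒lookup x∈S
  ...   | inU u = ⊥-elim (true≢false (begin
          true                                ≡⟨ sym j₀~x ⟩
          adj (complement G) (wv j₀) (uv u)   ≡⟨ complement-WU j₀ u ⟩
          lookup (hole j₀) u                  ≡⟨ cong (λ p → lookup p u) hole≡⊥ ⟩
          lookup ⊥ u                          ≡⟨ lookup-⊥ u ⟩
          false                               ∎))
    where open ≡-Reasoning

-- Lower bounds.  W is laid out as m fillers, then the hub, r singletons, h pairs.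

hubIx : ∀ m r h → Fin (m + suc (r + h))
hubIx m r h = m ↑ʳ zero

singIx : ∀ m r h → Fin r → Fin (m + suc (r + h))
singIx m r h u = m ↑ʳ suc (u ↑ˡ h)

pairIx : ∀ m r h → Fin h → Fin (m + suc (r + h))
pairIx m r h p = m ↑ʳ suc (r ↑ʳ p)

module LowerBounds (r h m : ℕ) (hole : Fin (m + suc (r + h)) → Subset r) (pair : Fin h → Subset r)
  (hole-hub : hole (hubIx m r h) ≡ ⊥)
  (hole-sing : ∀ u → hole (singIx m r h u) ≡ ⁅ u ⁆)
  (hole-pair : ∀ p → hole (pairIx m r h p) ≡ pair p)
  (pair-covers : ∀ u → Σ (Fin h) λ p → Σ (Fin r) λ z →
    z ≢ u × (∀ x → x ≢ u → lookup (pair p) x ≡ lookup ⁅ z ⁆ x))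
  where

  open HoleGraph r (m + suc (r + h)) hole

  hub≢sing : ∀ u → hubIx m r h ≢ singIx m r h u
  hub≢sing u eq with FinP.↑ʳ-injective m _ _ eq
  ... | ()

  sing≢sing : ∀ {u v} → u ≢ v → singIx m r h u ≢ singIx m r h v
  sing≢sing u≢v eq = u≢v (FinP.↑ˡ-injective h _ _ (FinP.suc-injective (FinP.↑ʳ-injective m _ _ eq)))

  pair≢hub : ∀ p → pairIx m r h p ≢ hubIx m r h
  pair≢hub p eq with FinP.↑ʳ-injective m _ _ eq
  ... | ()

  pair≢sing : ∀ p u → pairIx m r h p ≢ singIx m r h u
  pair≢sing p u eq with trans (sym (FinP.splitAt-↑ʳ r h p))
    (trans (cong (splitAt r) (FinP.suc-injective (FinP.↑ʳ-injective m _ _ eq))) (FinP.splitAt-↑ˡ r u h))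
  ... | ()

  module _ (S : Subset (r + (m + suc (r + h)))) (separating : Separating G S) where

    A : Fin r → Bool
    A u = lookup S (uv u)

    w : Fin (m + suc (r + h)) → Bool
    w j = lookup S (wv j)

    inHub : Bool
    inHub = w (hubIx m r h)

    C : Fin r → Bool
    C u = w (singIx m r h u)

    P : Fin h → Bool
    P p = w (pairIx m r h p)

    record _≈_ (X Y : Subset r) : Set where
      constructor same-trace
      field agree : ∀ u → A u ≡ true → lookup X u ≡ lookup Y u
    open _≈_

    ≈-sym : ∀ {X Y} → X ≈ Y → Y ≈ X
    ≈-sym X≈Y = same-trace λ u A[u] → sym (agree X≈Y u A[u])

    ≈-trans : ∀ {X Y Z} → X ≈ Y → Y ≈ Z → X ≈ Z
    ≈-trans X≈Y Y≈Z = same-trace λ u A[u] → trans (agree X≈Y u A[u]) (agree Y≈Z u A[u])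

    twin : ∀ {j k X Y} → hole j ≡ X → hole k ≡ Y → j ≢ k → X ≈ Y → w j ≡ false → w k ≡ true
    twin {j} {k} {X} {Y} hole-j hole-k j≢k X≈Y w[j] = BoolP.¬-not λ w[k] →
      separated-holes S separating j k w[j] w[k] j≢k λ u A[u] → begin
        lookup (hole j) u  ≡⟨ cong (λ Z → lookup Z u) hole-j ⟩
        lookup X u         ≡⟨ agree X≈Y u A[u] ⟩
        lookup Y u         ≡⟨ cong (λ Z → lookup Z u) (sym hole-k) ⟩
        lookup (hole k) u  ∎
      where open ≡-Reasoning

    outside≢inside : ∀ {u x} → A u ≡ false → A x ≡ true → x ≢ u
    outside≢inside A[u] A[x] refl = true≢false (trans (sym A[x]) A[u])

    ⊥≈⁅⁆ : ∀ u → A u ≡ false → ⊥ ≈ ⁅ u ⁆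
    ⊥≈⁅⁆ u A[u] = same-trace λ x A[x] → trans (lookup-⊥ x) (sym (lookup-⁅⁆-≢ (outside≢inside A[u] A[x])))

    pair≈⁅⁆ : ∀ {u₀ p z} → A u₀ ≡ false →
      (∀ x → x ≢ u₀ → lookup (pair p) x ≡ lookup ⁅ z ⁆ x) → pair p ≈ ⁅ z ⁆
    pair≈⁅⁆ A[u₀] away-from-u₀ = same-trace λ x A[x] → away-from-u₀ x (outside≢inside A[u₀] A[x])

    covered : Fin r → Bool
    covered u = A u ∨ C u

    at-most-one-uncovered : ∀ u v → u ≢ v → covered u ≡ false → ¬ (covered v ≡ false)
    at-most-one-uncovered u v u≢v unc-u unc-v with ∨-false _ _ unc-u | ∨-false _ _ unc-v
    ... | A[u] , C[u] | A[v] , C[v] = true≢false (trans (sym C[v]≡true) C[v])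
      where
      C[v]≡true : C v ≡ true
      C[v]≡true = twin (hole-sing u) (hole-sing v) (sing≢sing u≢v)
        (≈-trans (≈-sym (⊥≈⁅⁆ u A[u])) (⊥≈⁅⁆ v A[v])) C[u]

    uncovered⇒hub : ∀ u → covered u ≡ false → inHub ≡ true
    uncovered⇒hub u unc-u with ∨-false _ _ unc-u
    ... | A[u] , C[u] = twin (hole-sing u) hole-hub (hub≢sing u ∘ sym) (≈-sym (⊥≈⁅⁆ u A[u])) C[u]

    covering-bound : r ≤ bit inHub + count covered
    covering-bound = count-almost-all covered inHub at-most-one-uncovered uncovered⇒hub

    both : Fin r → Bool
    both u = A u ∧ C u

    A+C : count A + count C ≡ count covered + count both
    A+C = count-∨∧ A C

    core-bound : r ≤ bit inHub + (count A + count C)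
    core-bound = ℕP.≤-trans covering-bound (ℕP.+-monoʳ-≤ (bit inHub)
      (subst (count covered ≤_) (sym A+C) (ℕP.m≤m+n _ _)))

    size-UW : ∣ S ∣ ≡ count A + count w
    size-UW = trans (∣∣≡count S) (count-++ r (lookup S))

    size : ∣ S ∣ ≡ count A + (count (λ e → w (e ↑ˡ suc (r + h))) + (bit inHub + (count C + count P)))
    size = trans size-UW (cong (count A +_) (trans (count-++ m w)
      (cong (λ c → count (λ e → w (e ↑ˡ suc (r + h))) + (bit inHub + c)) (count-++ r (λ i → w (m ↑ʳ suc i))))))

    size-≥ : bit inHub + (count A + count C) + count P ≤ ∣ S ∣
    size-≥ = subst₂ _≤_ (sym (rearrange (count A) (bit inHub) (count C) (count P))) (sym size)
      (ℕP.+-monoʳ-≤ (count A) (ℕP.m≤n+m _ (count (λ e → w (e ↑ˡ suc (r + h))))))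
      where
      rearrange : ∀ a b c p → b + (a + c) + p ≡ a + (b + (c + p))
      rearrange = solve-∀

    lower-bound : r ≤ ∣ S ∣
    lower-bound = ℕP.≤-trans core-bound (ℕP.≤-trans (ℕP.m≤m+n _ (count P)) size-≥)

    U⊆S-bound : (inHub ≡ false → Σ (Fin (m + suc (r + h))) λ j → w j ≡ true) → (∀ u → A u ≡ true) → r + 1 ≤ ∣ S ∣
    U⊆S-bound hub-dominated U⊆S = subst (r + 1 ≤_) (sym size-UW) (ℕP.+-mono-≤ (count-all A U⊆S) S-meets-W)
      where
      S-meets-W : 1 ≤ count w
      S-meets-W with inHub BoolP.≟ true
      ... | yes hub-in = count-≥1 w (hubIx m r h) hub-in
      ... | no hub-out with hub-dominated (BoolP.¬-not hub-out)
      ...   | j , w[j] = count-≥1 w j w[j]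

    -- A pair vertex outside S, for the pair {u₀, z} with u₀ ∉ S, with z ∉ S:
    -- it has the trace of ∅, so the hub and every singleton vertex of an
    -- uncovered point would be its twin.
    pair-outside-z-outside : ∀ {u₀ p z} → A u₀ ≡ false →
      (∀ x → x ≢ u₀ → lookup (pair p) x ≡ lookup ⁅ z ⁆ x) → P p ≡ false → A z ≡ false →
      r + 1 ≤ bit inHub + (count A + count C)
    pair-outside-z-outside {p = p} {z} A[u₀] away-from-u₀ P[p] A[z] =
      subst (λ b → r + 1 ≤ bit b + (count A + count C)) (sym hub-in)
        (subst (_≤ suc (count A + count C)) (ℕP.+-comm 1 r)
          (s≤s (ℕP.≤-trans (count-all covered all-covered)
            (subst (count covered ≤_) (sym A+C) (ℕP.m≤m+n _ _)))))
      where
      pair≈⊥ : pair p ≈ ⊥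
      pair≈⊥ = ≈-trans (pair≈⁅⁆ A[u₀] away-from-u₀) (≈-sym (⊥≈⁅⁆ z A[z]))
      hub-in : inHub ≡ true
      hub-in = twin (hole-pair p) hole-hub (pair≢hub p) pair≈⊥ P[p]
      all-covered : ∀ u → covered u ≡ true
      all-covered u = BoolP.¬-not λ unc-u →
        let A[u] , C[u] = ∨-false _ _ unc-u
        in true≢false (trans (sym (twin (hole-pair p) (hole-sing u) (pair≢sing p u)
             (≈-trans pair≈⊥ (⊥≈⁅⁆ u A[u])) P[p])) C[u])

    -- The same with z ∈ S: the pair vertex is a twin of the singleton vertex
    -- of z, which is therefore in S although z is already covered.
    pair-outside-z-inside : ∀ {u₀ p z} → A u₀ ≡ false →
      (∀ x → x ≢ u₀ → lookup (pair p) x ≡ lookup ⁅ z ⁆ x) → P p ≡ false → A z ≡ true →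
      r + 1 ≤ bit inHub + (count A + count C)
    pair-outside-z-inside {p = p} {z} A[u₀] away-from-u₀ P[p] A[z] = subst (r + 1 ≤_) total
      (ℕP.+-mono-≤ covering-bound (count-≥1 both z (cong₂ _∧_ A[z] C[z])))
      where
      C[z] : C z ≡ true
      C[z] = twin (hole-pair p) (hole-sing z) (pair≢sing p z) (pair≈⁅⁆ A[u₀] away-from-u₀) P[p]
      total : bit inHub + count covered + count both ≡ bit inHub + (count A + count C)
      total = trans (ℕP.+-assoc (bit inHub) _ _) (cong (bit inHub +_) (sym A+C))

    -- If u₀ ∉ S, the pair {u₀, z} forces an extra vertex: the pair vertex, or
    -- else the hub or the singleton vertex of z.
    U⊈S-bound : ∀ u₀ → A u₀ ≡ false → r + 1 ≤ ∣ S ∣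
    U⊈S-bound u₀ A[u₀] with pair-covers u₀
    ... | p , z , _ , away-from-u₀ with P p in P[p] | A z in A[z]
    ...   | true | _ = ℕP.≤-trans (ℕP.+-mono-≤ core-bound (count-≥1 P p P[p])) size-≥
    ...   | false | true = ℕP.≤-trans (pair-outside-z-inside A[u₀] away-from-u₀ P[p] A[z])
            (ℕP.≤-trans (ℕP.m≤m+n _ (count P)) size-≥)
    ...   | false | false = ℕP.≤-trans (pair-outside-z-outside A[u₀] away-from-u₀ P[p] A[z])
            (ℕP.≤-trans (ℕP.m≤m+n _ (count P)) size-≥)

    -- In the complement, where S must also dominate the hub, one more vertex is needed.
    lower-bound⁺ : (inHub ≡ false → Σ (Fin (m + suc (r + h))) λ j → w j ≡ true) → r + 1 ≤ ∣ S ∣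
    lower-bound⁺ hub-dominated with FinP.all? (λ u → A u BoolP.≟ true)
    ... | yes U⊆S = U⊆S-bound hub-dominated U⊆S
    ... | no U⊈S with FinP.¬∀⟶∃¬ r _ (λ u → A u BoolP.≟ true) U⊈S
    ...   | u₀ , A[u₀]≢true = U⊈S-bound u₀ (BoolP.¬-not A[u₀]≢true)

Realisable : ℕ → ℕ → Set
Realisable r s = Σ ℕ λ n → Σ (Graph n) λ G → Σ (Subset n) λ U → Σ (Subset n) λ W →
  Connected G × BipartiteWith G U W × ∣ U ∣ ≡ r × ∣ W ∣ ≡ s ×
  (∃ λ k → IsLDNumber G k × IsLDNumber (complement G) (k + 1))

module Construction (t m : ℕ) (room : suc (m + suc (Specials.r t + Specials.h t)) ≤ 2 ^ Specials.r t) where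

  open Specials t

  s : ℕ
  s = m + suc (r + h)

  codes : Σ (Fin s → Fin (2 ^ r)) λ g → Injective _≡_ _≡_ g ×
    (∀ k → g (m ↑ʳ k) ≡ code (special k)) × (∀ j → g j ≢ code (⊤ {r}))
  codes = extend (code (⊤ {r})) (code ∘ special) (special-injective ∘ code-injective)
    (λ k → special≢⊤ k ∘ code-injective) m room

  hole : Fin s → Subset r
  hole j = decode r (proj₁ codes j)

  hole-injective : Injective _≡_ _≡_ hole
  hole-injective = proj₁ (proj₂ codes) ∘ decode-injective r

  hole≢⊤ : ∀ j → hole j ≢ ⊤
  hole≢⊤ j eq = proj₂ (proj₂ (proj₂ codes)) j (trans (sym (code∘decode r _)) (cong code eq))

  hole-special : ∀ k → hole (m ↑ʳ k) ≡ special k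
  hole-special k = trans (cong (decode r) (proj₁ (proj₂ (proj₂ codes)) k)) (decode∘code (special k))

  open HoleGraph r s hole

  module Bounds = LowerBounds r h m hole (pair (suc t)) (hole-special zero)
    (λ u → trans (hole-special _) (cong special′ (FinP.splitAt-↑ˡ r u h)))
    (λ p → trans (hole-special _) (cong special′ (FinP.splitAt-↑ʳ r h p)))
    (pair-covers (suc t))

  λ[G] : IsLDNumber G r
  λ[G] = (Uset , U-locating hole≢⊤ hole-injective , Uset-size) ,
    λ S S-LD → Bounds.lower-bound S (LD⇒separating G S S-LD)

  λ[Ḡ] : IsLDNumber (complement G) (r + 1)
  λ[Ḡ] = (U+ hub , U+-locating hole-injective hub , U+-size hub) ,
    λ S S-LD → Bounds.lower-bound⁺ S (complement-LD⇒separating G S S-LD)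
      (hub-dominated hub (hole-special zero) S S-LD)
    where
    hub : Fin s
    hub = hubIx m r h

  realised : Realisable r s
  realised = r + s , G , Uset , Wset , connected hole≢⊤ (hubIx m r h) (hole-special zero) ,
    bipartite , Uset-size , Wset-size , r , λ[G] , λ[Ḡ]

⌈twice+n/2⌉ : ∀ a n → ⌈ 2 * a + n /2⌉ ≡ a + ⌈ n /2⌉
⌈twice+n/2⌉ zero n = refl
⌈twice+n/2⌉ (suc a) n = trans (cong ⌈_/2⌉ (twice-suc a n)) (cong suc (⌈twice+n/2⌉ a n))
  where
  twice-suc : ∀ a n → 2 * suc a + n ≡ 2 + (2 * a + n)
  twice-suc = solve-∀

-- 3r/2 + 1 ≤ s leaves room for the hub, the r singletons and the ⌈r/2⌉ pairs.
specials-fit : ∀ r s → 3 * r + 2 ≤ 2 * s → suc (r + ⌈ r /2⌉) ≤ s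
specials-fit r s 3r+2≤2s = subst₂ _≤_ half-lhs half-rhs (ℕP.⌈n/2⌉-mono 3r+2≤2s)
  where
  half-lhs : ⌈ 3 * r + 2 /2⌉ ≡ suc (r + ⌈ r /2⌉)
  half-lhs = trans (cong ⌈_/2⌉ (three r)) (⌈twice+n/2⌉ (suc r) r)
    where
    three : ∀ r → 3 * r + 2 ≡ 2 * suc r + r
    three = solve-∀
  half-rhs : ⌈ 2 * s /2⌉ ≡ s
  half-rhs = trans (cong ⌈_/2⌉ (sym (ℕP.+-identityʳ (2 * s))))
    (trans (⌈twice+n/2⌉ s 0) (ℕP.+-identityʳ s))

≤∸1⇒< : ∀ {s N} → 0 < N → s ≤ N ∸ 1 → s < N
≤∸1⇒< {N = suc N} _ s≤N = s≤s s≤N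

proposition4p10 : ∀ (r s : ℕ) → 3 ≤ r → 3 * r + 2 ≤ 2 * s → s ≤ 2 ^ r ∸ 1 →
    Σ ℕ λ n → Σ (Graph n) λ G → Σ (Subset n) λ U → Σ (Subset n) λ W →
      Connected G × BipartiteWith G U W × ∣ U ∣ ≡ r × ∣ W ∣ ≡ s ×
      (∃ λ k → IsLDNumber G k × IsLDNumber (complement G) (k + 1))
proposition4p10 r@(suc (suc (suc t))) s (s≤s (s≤s (s≤s _))) 3r+2≤2s s≤2^r∸1 =
  subst (Realisable r) m+K≡s (Construction.realised t m room)
  where
  K : ℕ
  K = suc (r + ⌈ r /2⌉)
  m : ℕ
  m = s ∸ K
  m+K≡s : m + K ≡ s
  m+K≡s = ℕP.m∸n+n≡m (specials-fit r s 3r+2≤2s)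
  room : suc (m + K) ≤ 2 ^ r
  room = subst (λ n → suc n ≤ 2 ^ r) (sym m+K≡s) (≤∸1⇒< (ℕP.m^n>0 2 r) s≤2^r∸1)
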